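{- Let $(N,C)$ be a coherent net, where $N$ has places $p_1,\dots,p_n$, and let $\tau^*_C(\vec x,\vec x')$ be a Presburger formula such that for every marking $m\models C$ and every marking $m'$, $\tau^*_C(m,m')$ holds iff $m\xRightarrow{\epsilon}m'$. Then for all markings $m,m'$ with $m\models C$ and every $a\in\Sigma\cup\{0\}$, the formula $\hat T_C(m,m',a)$ holds if and only if either ($a=0$ and $m\xRightarrow{\epsilon}m'$) or ($a\in\Sigma$ and $m\xRightarrow{a}m'$).
   Context: A labeled Petri net $N=(P,T,\mathrm{Pre},\mathrm{Post})$ has finite place set $P=\{p_1,\dots,p_n\}$, finite transition set $T$, $\mathrm{Pre},\mathrm{Post}:T\to(P\to\mathbb N)$, and labeling $l:T\to\Sigma\cup\{\tau\}$ with $\tau$ the silent action. Labels are encoded as natural numbers: $\Sigma\subseteq\mathbb N\setminus\{0\}$ and $\tau$ is encoded by $0$. A marking $m:P\to\mathbb N$ is identified with a vector in $\mathbb N^n$. Transition $t$ is enabled at $m$ if $m\ge\mathrm{Pre}(t)$ componentwise, and then $m\xrightarrow{t}m'$ with $m'=m-\mathrm{Pre}(t)+\mathrm{Post}(t)$; $m\xRightarrow{\varrho}m'$ for $\varrho\in T^*$ is firing along $\varrho$. Extend $l$ to $T^*$ by erasing $\tau$. For $\sigma\in\Sigma^*$, $m\xRightarrow{\sigma}m'$ means there is $\varrho$ with $m\xRightarrow{\varrho}m'$ and $l(\varrho)=\sigma$ (so $m\xRightarrow{\epsilon}m'$ means reachability by silent transitions only). $m\overset{\epsilon}{\twoheadrightarrow}m'$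 iff $m'=m$; for $\sigma\in\Sigma^*,a\in\Sigma$, $m\overset{\sigma a}{\twoheadrightarrow}m'$ iff there exist $m''$ and $t$ with $l(t)=a$ and $m\xRightarrow{\sigma}m''\xrightarrow{t}m'$. A Presburger formula $C$ over the places is a coherency constraint; $(N,C)$ is a coherent net if for every $m\models C$, $\sigma\in\Sigma^*$ and $m\xRightarrow{\sigma}m'$ there is $m''\models C$ with $m\overset{\sigma}{\twoheadrightarrow}m''$ and $m''\xRightarrow{\epsilon}m'$. Formulas: $\mathrm{ENBL}_t(\vec x)\triangleq\bigwedge_{i}x_i\ge\mathrm{Pre}(t,p_i)$; $\Delta_t(\vec x,\vec x')\triangleq\bigwedge_i x_i'=x_i+\mathrm{Post}(t,p_i)-\mathrm{Pre}(t,p_i)$; $T(\vec x,\vec x',a)\triangleq\bigvee_{t\in T}(\mathrm{ENBL}_t(\vec x)\wedge\Delta_t(\vec x,\vec x')\wedge a=l(t))$; $\overleftarrow{T}_C(\vec x,\vec x',a)\triangleq\exists\vec x''.\ \tau^*_C(\vec x,\vec x'')\wedge T(\vec x'',\vec x',a)$; and $\hat T_C(\vec x,\vec x',a)\triangleq\big(\exists\vec x_1.\ \overleftarrow{T}_C(\vec x,\vec x_1,a)\wedge C(\vec x_1)\wedge\tau^*_C(\vec x_1,\vec x')\big)\vee\big(a=0\wedge\tau^*_C(\vec x,\vec x')\big)$. -}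

module Defs where

open import Data.Nat using (ℕ; zero; suc; _+_; _∸_; _≤_)
open import Data.Fin using (Fin)
open import Data.Vec using (Vec; lookup; tabulate; _∷_; _++_)
open import Data.List using (List; []; _∷_; map; _∷ʳ_)
open import Data.Product using (Σ; ∃; _×_; _,_)
open import Data.Sum using (_⊎_)
open import Data.List.Relation.Unary.All using (All)
open import Data.Empty using (⊥)
open import Data.Unit using (⊤)
open import Relation.Nullary using (¬_)
open import Relation.Binary.PropositionalEquality using (_≡_)

data Term (k : ℕ) : Set where
  var  : Fin k → Term k
  cst  : ℕ → Term k
  _⊕_  : Term k → Term k → Term k

data Formula : ℕ → Set where
  tt ff : ∀ {k} → Formula k
  _≤ᶠ_ _≡ᶠ_ : ∀ {k} → Term k → Term k → Formula k
  ¬ᶠ_  : ∀ {k} → Formula k → Formula k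
  _∧ᶠ_ _∨ᶠ_ : ∀ {k} → Formula k → Formula k → Formula k
  ∃ᶠ_  : ∀ {k} → Formula (suc k) → Formula k

evalT : ∀ {k} → Term k → Vec ℕ k → ℕ
evalT (var i) ρ = lookup ρ i
evalT (cst c) ρ = c
evalT (s ⊕ t) ρ = evalT s ρ + evalT t ρ

⟦_⟧ : ∀ {k} → Formula k → Vec ℕ k → Set
⟦ tt ⟧ ρ = ⊤
⟦ ff ⟧ ρ = ⊥
⟦ s ≤ᶠ t ⟧ ρ = evalT s ρ ≤ evalT t ρ
⟦ s ≡ᶠ t ⟧ ρ = evalT s ρ ≡ evalT t ρ
⟦ ¬ᶠ φ ⟧ ρ = ¬ ⟦ φ ⟧ ρ
⟦ φ ∧ᶠ ψ ⟧ ρ = ⟦ φ ⟧ ρ × ⟦ ψ ⟧ ρ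
⟦ φ ∨ᶠ ψ ⟧ ρ = ⟦ φ ⟧ ρ ⊎ ⟦ ψ ⟧ ρ
⟦ ∃ᶠ φ ⟧ ρ = Σ ℕ λ v → ⟦ φ ⟧ (v ∷ ρ)

⟦_⟧₂ : ∀ {n} → Formula (n + n) → Vec ℕ n → Vec ℕ n → Set
⟦ φ ⟧₂ x x' = ⟦ φ ⟧ (x ++ x')

-- Labeled Petri nets with n places and k transitions (T = Fin k);
-- labels are naturals, 0 encodes τ.

Marking : ℕ → Set
Marking n = Vec ℕ n

record Net (n k : ℕ) : Set where
  field
    Pre  : Fin k → Vec ℕ n
    Post : Fin k → Vec ℕ n
    lab  : Fin k → ℕ
open Net public

module _ {n k : ℕ} (N : Net n k) where

  Enabled : Fin k → Marking n → Set
  Enabled t m = ∀ i → lookup (Pre N t) i ≤ lookup m i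

  fire : Fin k → Marking n → Marking n
  fire t m = tabulate λ i → lookup m i ∸ lookup (Pre N t) i + lookup (Post N t) i

  Step : Marking n → Fin k → Marking n → Set
  Step m t m' = Enabled t m × m' ≡ fire t m

  data Run : Marking n → List (Fin k) → Marking n → Set where
    done : ∀ {m} → Run m [] m
    step : ∀ {m m₁ m' t ρ} → Step m t m₁ → Run m₁ ρ m' → Run m (t ∷ ρ) m'

  erase : List ℕ → List ℕ
  erase [] = []
  erase (zero ∷ as) = erase as
  erase (suc a ∷ as) = suc a ∷ erase as

  _⇒[_]_ : Marking n → List ℕ → Marking n → Set
  m ⇒[ σ ] m' = Σ (List (Fin k)) λ ρ → Run m ρ m' × erase (map (lab N) ρ) ≡ σ

  _↠[_]_ : Marking n → List ℕ → Marking n → Set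
  m ↠[ σ ] m' =
      (σ ≡ [] × m' ≡ m)
    ⊎ Σ (List ℕ) λ σ₀ → Σ ℕ λ a → σ ≡ σ₀ ∷ʳ a ×
        Σ (Marking n) λ m'' → Σ (Fin k) λ t →
          lab N t ≡ a × m ⇒[ σ₀ ] m'' × Step m'' t m'

  -- coherency (Σ-words are lists all of whose letters satisfy `Sig`)
  Coherent : (Sig : ℕ → Set) → Formula n → Set
  Coherent Sig C = ∀ (m : Marking n) → ⟦ C ⟧ m →
    ∀ (σ : List ℕ) → All Sig σ → ∀ (m' : Marking n) → m ⇒[ σ ] m' →
    Σ (Marking n) λ m'' → ⟦ C ⟧ m'' × m ↠[ σ ] m'' × m'' ⇒[ [] ] m'

  ENBL : Fin k → Vec ℕ n → Set
  ENBL t x = ∀ i → lookup x i ≥' lookup (Pre N t) i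
    where _≥'_ : ℕ → ℕ → Set
          a ≥' b = b ≤ a

  -- x'_i = x_i + Post(t,p_i) - Pre(t,p_i), written over ℕ without truncation
  Δ : Fin k → Vec ℕ n → Vec ℕ n → Set
  Δ t x x' = ∀ i → lookup x' i + lookup (Pre N t) i ≡ lookup x i + lookup (Post N t) i

  Tf : Vec ℕ n → Vec ℕ n → ℕ → Set
  Tf x x' a = Σ (Fin k) λ t → ENBL t x × Δ t x x' × a ≡ lab N t

  module _ (C : Formula n) (τ* : Formula (n + n)) where

    Tback : Vec ℕ n → Vec ℕ n → ℕ → Set
    Tback x x' a = Σ (Vec ℕ n) λ x'' → ⟦ τ* ⟧₂ x x'' × Tf x'' x' a

    That : Vec ℕ n → Vec ℕ n → ℕ → Set
    That x x' a =
        (Σ (Vec ℕ n) λ x₁ → Tback x x₁ a × ⟦ C ⟧ x₁ × ⟦ τ* ⟧₂ x₁ x')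
      ⊎ (a ≡ 0 × ⟦ τ* ⟧₂ x x')

-- A transition of T̂_C is a firing preceded and followed by silent runs, and
-- τ*_C reads silent runs correctly from C-markings; so T̂_C is sound because runs
-- compose. Conversely, coherence turns a weak a-step m ⇒[ a ] m' into a silent
-- run, an a-transition into a C-marking m'', and a silent run from m'' to m',
-- which is precisely a witness of the first disjunct of T̂_C.
module Submission where

open import Defs
open import Data.Nat using (ℕ; zero; suc; _+_; _∸_; _≤_)
open import Data.Nat.Properties using (m+n∸n≡m; m∸n+n≡m; +-∸-comm; ≤-trans; m≤m+n)
open import Data.List using (List; []; [_]; _∷_; _++_; map)
open import Data.List.Properties using (map-++; ++-identityʳ; ∷ʳ-injective)
open import Data.List.Relation.Unary.All using (All)
open import Data.Vec using (Vec; lookup)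
open import Data.Vec.Properties using (lookup∘tabulate)
open import Data.Vec.Relation.Binary.Pointwise.Extensional using (ext; Pointwise-≡⇒≡)
open import Data.Fin using (Fin)
open import Data.Product using (Σ; _×_; _,_)
open import Data.Sum using (_⊎_; inj₁; inj₂)
open import Relation.Nullary using (¬_)
open import Relation.Binary.PropositionalEquality
  using (_≡_; refl; sym; trans; cong; cong₂; subst; module ≡-Reasoning)
open import Function.Bundles using (_⇔_; mk⇔; Equivalence)

open Equivalence

m+n≡o+p⇔m≡o∸n+p : ∀ {m n o p} → n ≤ o → (m + n ≡ o + p ⇔ m ≡ o ∸ n + p)
m+n≡o+p⇔m≡o∸n+p {m} {n} {o} {p} n≤o = mk⇔ forward backward
  where
  open ≡-Reasoning
  forward : m + n ≡ o + p → m ≡ o ∸ n + p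
  forward eq = begin
    m             ≡⟨ sym (m+n∸n≡m m n) ⟩
    m + n ∸ n     ≡⟨ cong (_∸ n) eq ⟩
    o + p ∸ n     ≡⟨ +-∸-comm p n≤o ⟩
    o ∸ n + p     ∎
  backward : m ≡ o ∸ n + p → m + n ≡ o + p
  backward refl = begin
    o ∸ n + p + n ≡⟨ cong (_+ n) (sym (+-∸-comm p n≤o)) ⟩
    o + p ∸ n + n ≡⟨ m∸n+n≡m (≤-trans n≤o (m≤m+n o p)) ⟩
    o + p         ∎

module _ {n k : ℕ} (N : Net n k) where

  Δ⇔≡fire : ∀ {t} {x x' : Vec ℕ n} → Enabled N t x → (Δ N t x x' ⇔ x' ≡ fire N t x)
  Δ⇔≡fire {t} {x} en = mk⇔ forward backward
    where
    forward : ∀ {x'} → Δ N t x x' → x' ≡ fire N t x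
    forward d = Pointwise-≡⇒≡ (ext λ i →
      trans (to (m+n≡o+p⇔m≡o∸n+p (en i)) (d i)) (sym (lookup∘tabulate _ i)))
    backward : ∀ {x'} → x' ≡ fire N t x → Δ N t x x'
    backward refl i = from (m+n≡o+p⇔m≡o∸n+p (en i)) (lookup∘tabulate _ i)

  Tf⇔Step : ∀ {x x' : Vec ℕ n} {a} →
    Tf N x x' a ⇔ Σ (Fin k) λ t → a ≡ lab N t × Step N x t x'
  Tf⇔Step {x} {x'} = mk⇔
    (λ (t , en , d , a≡) → t , a≡ , en , to (Δ⇔≡fire {t} {x} {x'} en) d)
    (λ (t , a≡ , en , eq) → t , en , from (Δ⇔≡fire {t} {x} {x'} en) eq , a≡)

  Run-++ : ∀ {m m₁ m₂ ρ ρ'} → Run N m ρ m₁ → Run N m₁ ρ' m₂ → Run N m (ρ ++ ρ') m₂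
  Run-++ done r' = r'
  Run-++ (step s r) r' = step s (Run-++ r r')

  erase-++ : ∀ as bs → erase N (as ++ bs) ≡ erase N as ++ erase N bs
  erase-++ [] bs = refl
  erase-++ (zero ∷ as) bs = erase-++ as bs
  erase-++ (suc a ∷ as) bs = cong (suc a ∷_) (erase-++ as bs)

  ⇒-trans : ∀ {m m₁ m₂ σ σ'} → _⇒[_]_ N m σ m₁ → _⇒[_]_ N m₁ σ' m₂ →
    _⇒[_]_ N m (σ ++ σ') m₂
  ⇒-trans {σ = σ} {σ'} (ρ , r , e) (ρ' , r' , e') = ρ ++ ρ' , Run-++ r r' , erased
    where
    open ≡-Reasoning
    erased : erase N (map (lab N) (ρ ++ ρ')) ≡ σ ++ σ'
    erased = begin
      erase N (map (lab N) (ρ ++ ρ'))                     ≡⟨ cong (erase N) (map-++ (lab N) ρ ρ') ⟩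
      erase N (map (lab N) ρ ++ map (lab N) ρ')           ≡⟨ erase-++ (map (lab N) ρ) _ ⟩
      erase N (map (lab N) ρ) ++ erase N (map (lab N) ρ') ≡⟨ cong₂ _++_ e e' ⟩
      σ ++ σ'                                             ∎

  Step⇒ : ∀ {m t m'} → Step N m t m' → _⇒[_]_ N m (erase N [ lab N t ]) m'
  Step⇒ {t = t} s = [ t ] , step s done , refl

  ⇒[]-Step-⇒[] : ∀ {m m₁ m₂ m' t} → _⇒[_]_ N m [] m₁ → Step N m₁ t m₂ →
    _⇒[_]_ N m₂ [] m' → _⇒[_]_ N m (erase N [ lab N t ]) m'
  ⇒[]-Step-⇒[] p s q = subst (λ σ → _⇒[_]_ N _ σ _) (++-identityʳ _) (⇒-trans p (⇒-trans (Step⇒ s) q))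

  ↠-[_] : ∀ {m m'} a → _↠[_]_ N m [ a ] m' →
    Σ (Marking n) λ m₀ → Σ (Fin k) λ t → lab N t ≡ a × _⇒[_]_ N m [] m₀ × Step N m₀ t m'
  ↠-[ a ] (inj₁ (() , _))
  ↠-[ a ] (inj₂ (σ₀ , b , e , m₀ , t , lt≡b , p , s)) with ∷ʳ-injective [] σ₀ e
  ... | refl , refl = m₀ , t , lt≡b , p , s

  module _ (Sig : ℕ → Set) where

    ⇒-erase-[_] : ∀ {m m'} a → a ≡ 0 ⊎ Sig a → _⇒[_]_ N m (erase N [ a ]) m' →
      (a ≡ 0 × _⇒[_]_ N m [] m') ⊎ (Sig a × _⇒[_]_ N m [ a ] m')
    ⇒-erase-[ zero ] _ p = inj₁ (refl , p)
    ⇒-erase-[ suc a ] (inj₂ s) p = inj₂ (s , p)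

    module _ (C : Formula n) (τ* : Formula (n + n))
      (τ*⇔⇒[] : ∀ (m m' : Marking n) → ⟦ C ⟧ m → (⟦ τ* ⟧₂ m m' ⇔ _⇒[_]_ N m [] m'))
      where

      That-sound : ∀ {m m'} a → ⟦ C ⟧ m → a ≡ 0 ⊎ Sig a → That N C τ* m m' a →
        (a ≡ 0 × _⇒[_]_ N m [] m') ⊎ (Sig a × _⇒[_]_ N m [ a ] m')
      That-sound a Cm _ (inj₂ (a≡0 , τ)) = inj₁ (a≡0 , to (τ*⇔⇒[] _ _ Cm) τ)
      That-sound a Cm a∈ (inj₁ (x₁ , (x₀ , τ₀ , tf) , Cx₁ , τ₁)) with to (Tf⇔Step {x₀} {x₁}) tf
      ... | t , refl , s = ⇒-erase-[ lab N t ] a∈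
        (⇒[]-Step-⇒[] (to (τ*⇔⇒[] _ _ Cm) τ₀) s (to (τ*⇔⇒[] _ _ Cx₁) τ₁))

      That-complete : Coherent N Sig C → ∀ {m m'} a → ⟦ C ⟧ m →
        (a ≡ 0 × _⇒[_]_ N m [] m') ⊎ (Sig a × _⇒[_]_ N m [ a ] m') → That N C τ* m m' a
      That-complete _ a Cm (inj₁ (a≡0 , p)) = inj₂ (a≡0 , from (τ*⇔⇒[] _ _ Cm) p)
      That-complete coh a Cm (inj₂ (s , p)) with coh _ Cm [ a ] (s All.∷ All.[]) _ p
      ... | m'' , Cm'' , ↠m'' , p'' with ↠-[ a ] ↠m''
      ... | m₀ , t , lt≡a , p₀ , st =
        inj₁ (m'' , (m₀ , from (τ*⇔⇒[] _ _ Cm) p₀ , from (Tf⇔Step {m₀} {m''}) (t , sym lt≡a , st)) ,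
              Cm'' , from (τ*⇔⇒[] _ _ Cm'') p'')

lemma2 : ∀ {n k : ℕ} (N : Net n k) (Sig : ℕ → Set)
    → (∀ a → Sig a → ¬ (a ≡ 0))
    → (∀ t → lab N t ≡ 0 ⊎ Sig (lab N t))
    → (C : Formula n) → Coherent N Sig C
    → (τ* : Formula (n + n))
    → (∀ (m m' : Marking n) → ⟦ C ⟧ m → (⟦ τ* ⟧₂ m m' ⇔ _⇒[_]_ N m [] m'))
    → ∀ (m m' : Marking n) (a : ℕ) → ⟦ C ⟧ m → (a ≡ 0 ⊎ Sig a)
    → (That N C τ* m m' a ⇔ ((a ≡ 0 × _⇒[_]_ N m [] m') ⊎ (Sig a × _⇒[_]_ N m [ a ] m')))
lemma2 N Sig _ _ C coh τ* τ*⇔⇒[] m m' a Cm a∈ = mk⇔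
  (That-sound N Sig C τ* τ*⇔⇒[] a Cm a∈)
  (That-complete N Sig C τ* τ*⇔⇒[] coh a Cm)
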